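{- Let $v\in R$ and $t\in A^{\rm fin}_v$. Then there are $s\in F_v$ and $t'\in A^{\rm fin}_v$ such that $O_v(t')\le 0$ and $Z_v(t)=Z_v(t')+Z_v(s)$. In particular, $A^{\rm fin}_v=\{t'+s : t'\in A^{\rm fin}_v,\ O_v(t')\le 0,\ s\in F_v\}$, where $t'+s$ denotes the element $u\in A^{\rm fin}_v$ with $Z_v(u)=Z_v(t')+Z_v(s)$.
   Context: Let $\Sigma_\#=\{0,1,\#\}$ and $[b]_2=\sum_i b_i2^i$ for $b=b_0b_1\cdots\in\{0,1\}^*$. $R\subseteq\Sigma_\#^\omega$ is the set of words $(\#(0|1)^*1(0|1)^*)^\omega$; for $w=\#w_1\#w_2\#\cdots\in R$, $\alpha(w)=[0;[w_1]_2,[w_2]_2,\dots]$. For irrational $\alpha=[0;a_1,a_2,\dots]$ with convergents $p_k/q_k$ ($p_{ -1}=1,q_{ -1}=0,p_0=0,q_0=1$, $p_n=a_np_{n-1}+p_{n-2}$, $q_n=a_nq_{n-1}+q_{n-2}$), let $\beta_k=q_k\alpha-p_k$, $I_\alpha=[-\alpha,1-\alpha)$. Integer Ostrowski representation: $X=\sum_{n=0}^N b_{n+1}q_n$ with $0\le b_1<a_1$, $0\le b_{n+1}\le a_{n+1}$, $b_n=0$ whenever $b_{n+1}=a_{n+1}$. Real Ostrowski representation: $x\in I_\alpha$ is uniquely $\sum_{k\ge0}b_{k+1}\beta_k$ with $0\le b_k\le a_k$, $b_{k-1}=0$ whenever $b_k=a_k$, and $b_k\ne a_k$ for infinitely many odd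 $k$. Words in $\Sigma_\#^\omega$ are aligned if they have $\#$ at the same positions. For $v\in R$: $A_v$ is the set of $w=\#x_1\#x_2\#\cdots$ aligned with $v$ such that $[x_1]_2[x_2]_2\cdots$ is the $\alpha(v)$-Ostrowski representation of some $x\in I_{\alpha(v)}$, $O_v(w):=x$; $A^{\rm fin}_v\subseteq A_v$ is the set of such aligned $w$ whose digit sequence is the integer $\alpha(v)$-Ostrowski representation of some $N\in\mathbb{N}$, $Z_v(w):=N$. Finally $F_v:=\{s\in A^{\rm fin}_v : Z_v(s)\,\alpha(v)<1\}$. -}

module Defs where

open import Data.Bool using (Bool; true; false)
open import Data.List using (List; []; _∷_; length)
open import Data.List.Membership.Propositional using (_∈_)
open import Data.Nat as ℕ using (ℕ; zero; suc; pred)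
open import Data.Integer using (+_)
open import Data.Rational.Unnormalised as Q using (ℚᵘ; mkℚᵘ; 0ℚᵘ; 1ℚᵘ)
open import Data.Product using (Σ; ∃; _×_)
open import Relation.Binary.PropositionalEquality using (_≡_)

-- A word of the shape  # x₁ # x₂ # ⋯  (xᵢ ∈ {0,1}*) is represented by its
-- block sequence  i ↦ x_{i+1}  (bits as Bool, true = 1).  Every word of R,
-- and every word aligned with a word of R, has exactly this shape.

Word : Set
Word = ℕ → List Bool

bin : List Bool → ℕ
bin []           = 0
bin (false ∷ bs) = 2 ℕ.* bin bs
bin (true  ∷ bs) = suc (2 ℕ.* bin bs)

-- v ∈ R = (#(0|1)*1(0|1)*)^ω : every block contains a 1
InR : Word → Set
InR v = ∀ i → true ∈ v i

-- aligned: # at the same positions, i.e. blocks of equal length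
Aligned : Word → Word → Set
Aligned w v = ∀ i → length (w i) ≡ length (v i)

-- k-th digit (k ≥ 1) of a word: [x_k]₂ ; digit w 0 = 0 (unused)
digit : Word → ℕ → ℕ
digit w zero    = 0
digit w (suc k) = bin (w k)

-- partial quotients a_k = [w_k]₂ of α(v) = [0; a₁, a₂, …]
a : Word → ℕ → ℕ
a = digit

-- Shifted convergent sequences: Pˢ v (k+1) = p_k, Qˢ v (k+1) = q_k,
-- with Pˢ v 0 = p_{-1} = 1, Qˢ v 0 = q_{-1} = 0.
Pˢ : Word → ℕ → ℕ
Pˢ v zero = 1
Pˢ v (suc zero) = 0
Pˢ v (suc (suc n)) = a v (suc n) ℕ.* Pˢ v (suc n) ℕ.+ Pˢ v n

Qˢ : Word → ℕ → ℕ
Qˢ v zero = 0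
Qˢ v (suc zero) = 1
Qˢ v (suc (suc n)) = a v (suc n) ℕ.* Qˢ v (suc n) ℕ.+ Qˢ v n

p q : Word → ℕ → ℕ
p v k = Pˢ v (suc k)
q v k = Qˢ v (suc k)

sumℕ : ℕ → (ℕ → ℕ) → ℕ
sumℕ zero    f = 0
sumℕ (suc N) f = sumℕ N f ℕ.+ f N

sumℚ : ℕ → (ℕ → ℚᵘ) → ℚᵘ
sumℚ zero    f = 0ℚᵘ
sumℚ (suc N) f = sumℚ N f Q.+ f N

-- A^fin_v : words aligned with v whose digit sequence b₁ b₂ ⋯ is the
-- integer α(v)-Ostrowski representation of a natural number
-- (finitely many nonzero digits; 0 ≤ b₁ < a₁; 0 ≤ b_{n+1} ≤ a_{n+1};
--  b_n = 0 whenever b_{n+1} = a_{n+1}).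

record AFin (v t : Word) : Set where
  field
    aligned  : Aligned t v
    first<   : digit t 1 ℕ.< a v 1
    bounded  : ∀ n → digit t (suc n) ℕ.≤ a v (suc n)
    maxRule  : ∀ n → digit t (suc (suc n)) ≡ a v (suc (suc n)) → digit t (suc n) ≡ 0
    supp     : ℕ
    suppZero : ∀ n → supp ℕ.≤ n → digit t (suc n) ≡ 0

Z : ∀ {v t} → AFin v t → ℕ
Z {v} {t} h = sumℕ (AFin.supp h) (λ n → digit t (suc n) ℕ.* q v n)

-- Real numbers enter only through α = α(v) = lim_n p_n / q_n.
-- A real quantity is given by a sequence of rational approximations
-- obtained by replacing α by its n-th convergent p_n/q_n (q_n ≥ 1 when v ∈ R).

-- n-th convergent p_n / q_n  (denominator written as (q_n - 1) + 1)
conv : Word → ℕ → ℚᵘ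
conv v n = mkℚᵘ (+ p v n) (pred (q v n))

ℕ→ℚ : ℕ → ℚᵘ
ℕ→ℚ n = mkℚᵘ (+ n) 0

eps : ℕ → ℚᵘ
eps m = mkℚᵘ (+ 1) m

LimLe : (ℕ → ℚᵘ) → ℚᵘ → Set
LimLe f c = ∀ m → ∃ λ N → ∀ n → N ℕ.≤ n → f n Q.≤ c Q.+ eps m

LimLt : (ℕ → ℚᵘ) → ℚᵘ → Set
LimLt f c = ∃ λ m → ∃ λ N → ∀ n → N ℕ.≤ n → f n Q.+ eps m Q.≤ c

-- β_k = q_k α - p_k, approximated with α ↦ p_n/q_n
βapprox : Word → ℕ → ℕ → ℚᵘ
βapprox v k n = ℕ→ℚ (q v k) Q.* conv v n Q.- ℕ→ℚ (p v k)

-- O_v(t) = Σ_k b_{k+1} β_k  (a finite sum for t ∈ A^fin_v), approximated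
Oapprox : ∀ {v t} → AFin v t → ℕ → ℚᵘ
Oapprox {v} {t} h n = sumℚ (AFin.supp h) (λ k → ℕ→ℚ (digit t (suc k)) Q.* βapprox v k n)

Ononpos : ∀ {v t} → AFin v t → Set
Ononpos h = LimLe (Oapprox h) 0ℚᵘ

InF : ∀ {v s} → AFin v s → Set
InF {v} h = LimLt (λ n → ℕ→ℚ (Z h) Q.* conv v n) 1ℚᵘ

module Submission where

-- Write α = α(v) and β_k = q_k α − p_k. The integers q_k p_n − p_k q_n (k < n) have the sign (−1)^k
-- of β_k and satisfy the recurrence of the convergents in k; with the digit bounds b_{k+1} ≤ a_{k+1}
-- this bounds every tail Σ_{k>m} b_{k+1} β_k by |β_m|, so O_v(t) ≤ 0 as soon as the lowest nonzero
-- digit of t multiplies some β_k with k odd (α being read through its convergents p_n/q_n).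
-- If the lowest nonzero digit of t − b₁ multiplies β_k with k odd, or t − b₁ = 0, take t' = t − b₁
-- and Z_v(s) = b₁. Otherwise k is even and, since q_k − 1 = a₂q₁ + a₄q₃ + ⋯ + a_k q_{k−1},
-- t − b₁ − 1 has the digits 0, a₂, 0, a₄, …, 0, a_k, b_{k+1} − 1, b_{k+2}, … whose lowest nonzero
-- one multiplies β₁; take t' = t − b₁ − 1 and Z_v(s) = b₁ + 1. In both cases Z_v(s) ≤ a₁ < 1/α.

open import Defs
open import Data.Bool using (Bool; true; false; not; if_then_else_)
open import Data.Nat as ℕ using (_+_; ℕ; zero; suc; pred; _≤_; _<_; z≤n; s≤s; _≤′_; ≤′-refl; ≤′-step)
import Data.Nat.Properties as ℕP
open import Data.Integer as ℤ using (ℤ; +_; -[1+_]; +≤+; -≤+)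
import Data.Integer.Properties as ℤP
import Data.Nat.Solver as ℕSolver
import Data.Integer.Solver as ℤSolver
open import Data.Rational.Unnormalised as Q using (ℚᵘ; mkℚᵘ; 0ℚᵘ; 1ℚᵘ; *≤*; *≡*)
import Data.Rational.Unnormalised.Properties as QP
import Data.Rational.Unnormalised.Solver as QSolver
import Relation.Binary.Reasoning.Setoid as SetoidReasoning
open import Data.List using (List; []; _∷_; length)
open import Data.List.Relation.Unary.Any using (here; there)
open import Data.List.Membership.Propositional using (_∈_)
open import Data.Product using (Σ; ∃-syntax; _×_; _,_; proj₁)
open import Data.Empty using (⊥-elim)
open import Relation.Nullary using (yes; no)
open import Data.Sum using (_⊎_; inj₁; inj₂)
open import Relation.Binary.Definitions using (tri<; tri≈; tri>)
open import Function using (_∘_)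
open import Relation.Binary.PropositionalEquality

-- Parity and the cross determinants of the convergents

even : ℕ → Bool
even zero    = true
even (suc n) = not (even n)

even-+2 : ∀ n → even (suc (suc n)) ≡ even n
even-+2 n with even n
... | true  = refl
... | false = refl

AltSign : ℕ → ℤ → Set
AltSign m z = if even m then z ℤ.≤ + 0 else + 0 ℤ.≤ z

AltSign-even : ∀ m {z} → even m ≡ true → AltSign m z → z ℤ.≤ + 0
AltSign-even m {z} eq = subst (λ b → if b then z ℤ.≤ + 0 else + 0 ℤ.≤ z) eq

AltSign-odd : ∀ m {z} → even m ≡ false → AltSign m z → + 0 ℤ.≤ z
AltSign-odd m {z} eq = subst (λ b → if b then z ℤ.≤ + 0 else + 0 ℤ.≤ z) eq

AltSign-zero : ∀ m → AltSign m (+ 0)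
AltSign-zero m with even m
... | true  = ℤP.≤-refl
... | false = ℤP.≤-refl

AltSign-+* : ∀ m k {x y} → AltSign m x → AltSign m y → AltSign m (+ k ℤ.* x ℤ.+ y)
AltSign-+* m k {x} {y} hx hy with even m
... | true  = ℤP.+-mono-≤ {_} {+ 0} {_} {+ 0}
                (ℤP.≤-trans (ℤP.*-monoˡ-≤-nonNeg (+ k) hx) (ℤP.≤-reflexive (ℤP.*-zeroʳ (+ k)))) hy
... | false = ℤP.+-mono-≤ {+ 0} {_} {+ 0}
                (ℤP.≤-trans (ℤP.≤-reflexive (sym (ℤP.*-zeroʳ (+ k)))) (ℤP.*-monoˡ-≤-nonNeg (+ k) hx)) hy

module CrossDeterminant (v : Word) where

  open ℤSolver.+-*-Solver

  -- cross (k + 1) (n + 1) = q_k p_n - p_k q_n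
  cross : ℕ → ℕ → ℤ
  cross m N = + Qˢ v m ℤ.* + Pˢ v N ℤ.- + Pˢ v m ℤ.* + Qˢ v N

  private
    rec-ℤ : ∀ (X : ℕ → ℕ) → (∀ n → X (suc (suc n)) ≡ a v (suc n) ℕ.* X (suc n) ℕ.+ X n) →
          ∀ n → + X (suc (suc n)) ≡ + a v (suc n) ℤ.* + X (suc n) ℤ.+ + X n
    rec-ℤ X hX n = trans (cong +_ (hX n))
      (trans (ℤP.pos-+ (a v (suc n) ℕ.* X (suc n)) (X n)) (cong (ℤ._+ + X n) (ℤP.pos-* (a v (suc n)) (X (suc n)))))

  Pˢ-rec : ∀ n → + Pˢ v (suc (suc n)) ≡ + a v (suc n) ℤ.* + Pˢ v (suc n) ℤ.+ + Pˢ v n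
  Pˢ-rec = rec-ℤ (Pˢ v) (λ _ → refl)

  Qˢ-rec : ∀ n → + Qˢ v (suc (suc n)) ≡ + a v (suc n) ℤ.* + Qˢ v (suc n) ℤ.+ + Qˢ v n
  Qˢ-rec = rec-ℤ (Qˢ v) (λ _ → refl)

  cross-recʳ : ∀ m N → cross m (suc (suc N)) ≡ + a v (suc N) ℤ.* cross m (suc N) ℤ.+ cross m N
  cross-recʳ m N = trans (cong₂ (λ x y → + Qˢ v m ℤ.* x ℤ.- + Pˢ v m ℤ.* y) (Pˢ-rec N) (Qˢ-rec N))
    (solve 7 (λ c qm pm p₁ p₀ q₁ q₀ → qm :* (c :* p₁ :+ p₀) :- pm :* (c :* q₁ :+ q₀) :=
                                       c :* (qm :* p₁ :- pm :* q₁) :+ (qm :* p₀ :- pm :* q₀))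
       refl (+ a v (suc N)) (+ Qˢ v m) (+ Pˢ v m) (+ Pˢ v (suc N)) (+ Pˢ v N) (+ Qˢ v (suc N)) (+ Qˢ v N))

  cross-recˡ : ∀ m N → cross (suc (suc m)) N ≡ + a v (suc m) ℤ.* cross (suc m) N ℤ.+ cross m N
  cross-recˡ m N = trans (cong₂ (λ x y → x ℤ.* + Pˢ v N ℤ.- y ℤ.* + Qˢ v N) (Qˢ-rec m) (Pˢ-rec m))
    (solve 7 (λ c pN qN p₁ p₀ q₁ q₀ → (c :* q₁ :+ q₀) :* pN :- (c :* p₁ :+ p₀) :* qN :=
                                       c :* (q₁ :* pN :- p₁ :* qN) :+ (q₀ :* pN :- p₀ :* qN))
       refl (+ a v (suc m)) (+ Pˢ v N) (+ Qˢ v N) (+ Pˢ v (suc m)) (+ Pˢ v m) (+ Qˢ v (suc m)) (+ Qˢ v m))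

  cross-diag : ∀ m → cross m m ≡ + 0
  cross-diag m = solve 2 (λ q p → q :* p :- p :* q := con (+ 0)) refl (+ Qˢ v m) (+ Pˢ v m)

  cross-antisym : ∀ m N → cross m N ≡ ℤ.- cross N m
  cross-antisym m N = solve 4 (λ qm pN pm qN → qm :* pN :- pm :* qN := :- (qN :* pm :- pN :* qm))
    refl (+ Qˢ v m) (+ Pˢ v N) (+ Pˢ v m) (+ Qˢ v N)

  cross-adjacent : ∀ j → cross (suc j) j ≡ (if even j then + 1 else -[1+ 0 ])
  cross-adjacent zero    = refl
  cross-adjacent (suc j) = begin
    cross (suc (suc j)) (suc j)                          ≡⟨ cross-recˡ j (suc j) ⟩
    + a v (suc j) ℤ.* cross (suc j) (suc j) ℤ.+ cross j (suc j)
      ≡⟨ cong₂ (λ x y → + a v (suc j) ℤ.* x ℤ.+ y) (cross-diag (suc j)) (cross-antisym j (suc j)) ⟩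
    + a v (suc j) ℤ.* + 0 ℤ.+ ℤ.- cross (suc j) j
      ≡⟨ trans (cong (ℤ._+ ℤ.- cross (suc j) j) (ℤP.*-zeroʳ (+ a v (suc j)))) (ℤP.+-identityˡ _) ⟩
    ℤ.- cross (suc j) j                                  ≡⟨ cong ℤ.-_ (cross-adjacent j) ⟩
    ℤ.- (if even j then + 1 else -[1+ 0 ])               ≡⟨ neg-sign (even j) ⟩
    (if not (even j) then + 1 else -[1+ 0 ])             ∎
    where
    open ≡-Reasoning
    neg-sign : ∀ b → ℤ.- (if b then + 1 else -[1+ 0 ]) ≡ (if not b then + 1 else -[1+ 0 ])
    neg-sign true  = refl
    neg-sign false = refl

  private
    AltSign-base : ∀ m → AltSign m (cross m (pred m)) × AltSign m (cross m (suc (pred m)))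
    AltSign-base zero    = AltSign-zero 0 , -≤+
    AltSign-base (suc j) rewrite cross-diag (suc j) | cross-adjacent j = adjacent , AltSign-zero (suc j)
      where
      adjacent : AltSign (suc j) (if even j then + 1 else -[1+ 0 ])
      adjacent with even j
      ... | true  = +≤+ z≤n
      ... | false = -≤+

    AltSign-from : ∀ m d → AltSign m (cross m (pred m ℕ.+ d)) × AltSign m (cross m (suc (pred m ℕ.+ d)))
    AltSign-from m zero rewrite ℕP.+-identityʳ (pred m) = AltSign-base m
    AltSign-from m (suc d) rewrite ℕP.+-suc (pred m) d =
      let (h₀ , h₁) = AltSign-from m d in
      h₁ , subst (AltSign m) (sym (cross-recʳ m (pred m ℕ.+ d))) (AltSign-+* m (a v (suc (pred m ℕ.+ d))) h₁ h₀)

  cross-sign : ∀ m N → m ≤ suc N → AltSign m (cross m N)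
  cross-sign m N m≤1+N =
    subst (λ k → AltSign m (cross m k)) (ℕP.m+[n∸m]≡n pm≤N) (proj₁ (AltSign-from m (N ℕ.∸ pred m)))
    where
    pm≤N : pred m ≤ N
    pm≤N = ℕP.pred-mono-≤ m≤1+N

-- Alternating digit sums

sumFrom : (ℕ → ℤ) → ℕ → ℕ → ℤ
sumFrom f m zero    = + 0
sumFrom f m (suc L) = f m ℤ.+ sumFrom f (suc m) L

sumFrom-zero : ∀ {f} → (∀ j → f j ≡ + 0) → ∀ m L → sumFrom f m L ≡ + 0
sumFrom-zero f≡0 m zero    = refl
sumFrom-zero f≡0 m (suc L) = cong₂ ℤ._+_ (f≡0 m) (sumFrom-zero f≡0 (suc m) L)

sumFrom-snoc : ∀ f m L → sumFrom f m (suc L) ≡ sumFrom f m L ℤ.+ f (m ℕ.+ L)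
sumFrom-snoc f m zero    = trans (ℤP.+-comm (f m) (+ 0)) (cong (λ k → + 0 ℤ.+ f k) (sym (ℕP.+-identityʳ m)))
sumFrom-snoc f m (suc L) = begin
  f m ℤ.+ sumFrom f (suc m) (suc L)            ≡⟨ cong (λ x → f m ℤ.+ x) (sumFrom-snoc f (suc m) L) ⟩
  f m ℤ.+ (sumFrom f (suc m) L ℤ.+ f (suc m ℕ.+ L)) ≡⟨ ℤP.+-assoc (f m) _ _ ⟨
  f m ℤ.+ sumFrom f (suc m) L ℤ.+ f (suc m ℕ.+ L)
    ≡⟨ cong (λ k → f m ℤ.+ sumFrom f (suc m) L ℤ.+ f k) (ℕP.+-suc m L) ⟨
  f m ℤ.+ sumFrom f (suc m) L ℤ.+ f (m ℕ.+ suc L) ∎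
  where open ≡-Reasoning

*-nonpos : ∀ k {x} → x ℤ.≤ + 0 → + k ℤ.* x ℤ.≤ + 0
*-nonpos k x≤0 = ℤP.≤-trans (ℤP.*-monoˡ-≤-nonNeg (+ k) x≤0) (ℤP.≤-reflexive (ℤP.*-zeroʳ (+ k)))

module AlternatingSum (v : Word) (N : ℕ) (b : ℕ → ℕ) where

  open CrossDeterminant v

  term : ℕ → ℤ
  term j = + b j ℤ.* cross j N

  digitSum-cross : ∀ K →
    + sumℕ K (λ k → b (suc k) ℕ.* q v k) ℤ.* + Pˢ v N ℤ.-
    + sumℕ K (λ k → b (suc k) ℕ.* p v k) ℤ.* + Qˢ v N ≡ sumFrom term 1 K
  digitSum-cross zero    = refl
  digitSum-cross (suc K) = begin
    + (SQ ℕ.+ b (suc K) ℕ.* q v K) ℤ.* + Pˢ v N ℤ.- + (SP ℕ.+ b (suc K) ℕ.* p v K) ℤ.* + Qˢ v N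
      ≡⟨ cong₂ (λ x y → x ℤ.* + Pˢ v N ℤ.- y ℤ.* + Qˢ v N) (cast SQ (q v K)) (cast SP (p v K)) ⟩
    (+ SQ ℤ.+ + b (suc K) ℤ.* + q v K) ℤ.* + Pˢ v N ℤ.- (+ SP ℤ.+ + b (suc K) ℤ.* + p v K) ℤ.* + Qˢ v N
      ≡⟨ solve 7 (λ sq sp c qk pk pN qN → (sq :+ c :* qk) :* pN :- (sp :+ c :* pk) :* qN :=
                                          (sq :* pN :- sp :* qN) :+ c :* (qk :* pN :- pk :* qN))
           refl (+ SQ) (+ SP) (+ b (suc K)) (+ q v K) (+ p v K) (+ Pˢ v N) (+ Qˢ v N) ⟩
    (+ SQ ℤ.* + Pˢ v N ℤ.- + SP ℤ.* + Qˢ v N) ℤ.+ term (suc K)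
      ≡⟨ cong (ℤ._+ term (suc K)) (digitSum-cross K) ⟩
    sumFrom term 1 K ℤ.+ term (suc K)                          ≡⟨ sumFrom-snoc term 1 K ⟨
    sumFrom term 1 (suc K)                                     ∎
    where
    open ≡-Reasoning
    open ℤSolver.+-*-Solver
    SQ SP : ℕ
    SQ = sumℕ K (λ k → b (suc k) ℕ.* q v k)
    SP = sumℕ K (λ k → b (suc k) ℕ.* p v k)
    cast : ∀ s x → + (s ℕ.+ b (suc K) ℕ.* x) ≡ + s ℤ.+ + b (suc K) ℤ.* + x
    cast s x = trans (ℤP.pos-+ s _) (cong (λ y → + s ℤ.+ y) (ℤP.pos-* (b (suc K)) x))

  module _ (b≤a : ∀ m → b (suc m) ≤ a v (suc m)) where
    private
      neg-cross : ∀ m → ℤ.- cross m N ≡ + a v (suc m) ℤ.* cross (suc m) N ℤ.- cross (suc (suc m)) N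
      neg-cross m rewrite cross-recˡ m N =
        solve 3 (λ c x y → :- y := c :* x :- (c :* x :+ y)) refl (+ a v (suc m)) (cross (suc m) N) (cross m N)
        where open ℤSolver.+-*-Solver

      cross-nonpos : ∀ {m} → even m ≡ true → m ≤ suc N → cross m N ℤ.≤ + 0
      cross-nonpos {m} ev m≤ = AltSign-even m ev (cross-sign m N m≤)

      peel : ∀ m L → even m ≡ true → suc m ≤ N →
             sumFrom term (suc (suc m)) L ℤ.≤ ℤ.- cross (suc (suc m)) N →
             sumFrom term (suc m) (suc L) ℤ.≤ ℤ.- cross m N
      peel m L ev m<N rest = subst (sumFrom term (suc m) (suc L) ℤ.≤_) (sym (neg-cross m))
        (ℤP.+-mono-≤ (ℤP.*-monoʳ-≤-nonNeg (cross (suc m) N) {{ℤ.nonNegative cross-nonneg}} (+≤+ (b≤a m)))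
                     rest)
        where
        cross-nonneg : + 0 ℤ.≤ cross (suc m) N
        cross-nonneg = AltSign-odd (suc m) (cong not ev) (cross-sign (suc m) N (ℕP.m≤n⇒m≤1+n m<N))

    tail-bound : ∀ L m → even m ≡ true → m ℕ.+ L ≤ N → sumFrom term (suc m) L ℤ.≤ ℤ.- cross m N
    tail-bound zero m ev bound =
      ℤP.neg-mono-≤ (cross-nonpos {m} ev (ℕP.m≤n⇒m≤1+n (ℕP.m+n≤o⇒m≤o m bound)))
    tail-bound (suc zero) m ev bound = peel m zero ev m<N
      (ℤP.neg-mono-≤ (cross-nonpos (trans (even-+2 m) ev) (s≤s m<N)))
      where
      m<N : suc m ≤ N
      m<N = subst (_≤ N) (ℕP.+-comm m 1) bound
    tail-bound (suc (suc L)) m ev bound = peel m (suc L) ev (ℕP.m+n≤o⇒m≤o (suc m) bound₁)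
      (ℤP.≤-trans (ℤP.+-mono-≤ (*-nonpos (b (suc (suc m)))
                                          (cross-nonpos ev₂ (s≤s (ℕP.m+n≤o⇒m≤o (suc m) bound₁))))
                               (tail-bound L (suc (suc m)) ev₂ bound₂))
                  (ℤP.≤-reflexive (ℤP.+-identityˡ _)))
      where
      ev₂ : even (suc (suc m)) ≡ true
      ev₂ = trans (even-+2 m) ev
      bound₁ : suc m ℕ.+ suc L ≤ N
      bound₁ = subst (_≤ N) (ℕP.+-suc m (suc L)) bound
      bound₂ : suc (suc m) ℕ.+ L ≤ N
      bound₂ = subst (_≤ N) (ℕP.+-suc (suc m) L) bound₁

    lead-nonpos : ∀ L m {j} → even j ≡ true → 1 ≤ b j → (∀ i → i < j → b i ≡ 0) →
                  m ≤ j → j < m ℕ.+ L → m ℕ.+ L ≤ suc N → sumFrom term m L ℤ.≤ + 0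
    lead-nonpos zero m _ _ _ m≤j j<m+0 _ =
      ⊥-elim (ℕP.<-irrefl refl (ℕP.≤-<-trans m≤j (subst (_ <_) (ℕP.+-identityʳ m) j<m+0)))
    lead-nonpos (suc L) m {j} ev b≥1 below m≤j j<m+L bound with m ℕ.≟ j
    ... | yes refl = ℤP.≤-trans (ℤP.+-monoʳ-≤ (term m) (tail-bound L m ev m+L≤N))
                                (lead-term (b m) b≥1 (cross-nonpos ev m≤1+N))
      where
      m+L≤N : m ℕ.+ L ≤ N
      m+L≤N = ℕP.≤-pred (subst (_≤ suc N) (ℕP.+-suc m L) bound)
      m≤1+N : m ≤ suc N
      m≤1+N = ℕP.m≤n⇒m≤1+n (ℕP.m+n≤o⇒m≤o m m+L≤N)
      lead-term : ∀ k {x} → 1 ≤ k → x ℤ.≤ + 0 → + k ℤ.* x ℤ.- x ℤ.≤ + 0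
      lead-term (suc k) {x} _ x≤0 = subst (ℤ._≤ + 0)
        (solve 2 (λ k x → k :* x := (con (+ 1) :+ k) :* x :- x) refl (+ k) x) (*-nonpos k x≤0)
        where open ℤSolver.+-*-Solver
    ... | no m≢j = subst (ℤ._≤ + 0) (sym head-vanishes)
      (lead-nonpos L (suc m) ev b≥1 below (ℕP.≤∧≢⇒< m≤j m≢j)
        (subst (j <_) (ℕP.+-suc m L) j<m+L) (subst (_≤ suc N) (ℕP.+-suc m L) bound))
      where
      head-vanishes : sumFrom term m (suc L) ≡ sumFrom term (suc m) L
      head-vanishes =
        trans (cong (λ k → + k ℤ.* cross m N ℤ.+ sumFrom term (suc m) L) (below m (ℕP.≤∧≢⇒< m≤j m≢j)))
              (ℤP.+-identityˡ _)

-- The sign of O_v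

ℕ→ℚ-+ : ∀ x y → ℕ→ℚ (x ℕ.+ y) Q.≃ ℕ→ℚ x Q.+ ℕ→ℚ y
ℕ→ℚ-+ x y = *≡* (trans (cong (ℤ._* + 1) (ℤP.pos-+ x y))
  (solve 2 (λ x y → (x :+ y) :* con (+ 1) := (x :* con (+ 1) :+ y :* con (+ 1)) :* con (+ 1)) refl (+ x) (+ y)))
  where open ℤSolver.+-*-Solver

ℕ→ℚ-* : ∀ x y → ℕ→ℚ (x ℕ.* y) Q.≃ ℕ→ℚ x Q.* ℕ→ℚ y
ℕ→ℚ-* x y = *≡* (cong (ℤ._* + 1) (ℤP.pos-* x y))

sumℚ-affine : ∀ (B X Y : ℕ → ℕ) c K →
  sumℚ K (λ k → ℕ→ℚ (B k) Q.* (ℕ→ℚ (X k) Q.* c Q.- ℕ→ℚ (Y k))) Q.≃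
  ℕ→ℚ (sumℕ K (λ k → B k ℕ.* X k)) Q.* c Q.- ℕ→ℚ (sumℕ K (λ k → B k ℕ.* Y k))
sumℚ-affine B X Y c zero = solve 1 (λ c → con 0ℚᵘ := con 0ℚᵘ :* c :- con 0ℚᵘ) QP.≃-refl c
  where open QSolver.+-*-Solver
sumℚ-affine B X Y c (suc K) = begin
  sumℚ K F Q.+ F K                   ≈⟨ QP.+-congˡ (F K) (sumℚ-affine B X Y c K) ⟩
  (ℕ→ℚ SX Q.* c Q.- ℕ→ℚ SY) Q.+ F K
    ≈⟨ regroup (ℕ→ℚ SX) (ℕ→ℚ SY) (ℕ→ℚ (B K)) (ℕ→ℚ (X K)) (ℕ→ℚ (Y K)) c ⟩
  (ℕ→ℚ SX Q.+ ℕ→ℚ (B K) Q.* ℕ→ℚ (X K)) Q.* c Q.- (ℕ→ℚ SY Q.+ ℕ→ℚ (B K) Q.* ℕ→ℚ (Y K))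
    ≈⟨ QP.+-cong (QP.*-congʳ {c} (cast SX (X K))) (QP.-‿cong (cast SY (Y K))) ⟨
  ℕ→ℚ (SX ℕ.+ B K ℕ.* X K) Q.* c Q.- ℕ→ℚ (SY ℕ.+ B K ℕ.* Y K) ∎
  where
  open SetoidReasoning QP.≃-setoid
  F : ℕ → ℚᵘ
  F k = ℕ→ℚ (B k) Q.* (ℕ→ℚ (X k) Q.* c Q.- ℕ→ℚ (Y k))
  SX SY : ℕ
  SX = sumℕ K (λ k → B k ℕ.* X k)
  SY = sumℕ K (λ k → B k ℕ.* Y k)
  regroup : ∀ sx sy b x y c →
            (sx Q.* c Q.- sy) Q.+ b Q.* (x Q.* c Q.- y) Q.≃ (sx Q.+ b Q.* x) Q.* c Q.- (sy Q.+ b Q.* y)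
  regroup = solve 6 (λ sx sy b x y c → (sx :* c :- sy) :+ b :* (x :* c :- y) :=
                                       (sx :+ b :* x) :* c :- (sy :+ b :* y)) QP.≃-refl
    where open QSolver.+-*-Solver
  cast : ∀ s z → ℕ→ℚ (s ℕ.+ B K ℕ.* z) Q.≃ ℕ→ℚ s Q.+ ℕ→ℚ (B K) Q.* ℕ→ℚ z
  cast s z = QP.≃-trans (ℕ→ℚ-+ s (B K ℕ.* z)) (QP.+-congʳ (ℕ→ℚ s) (ℕ→ℚ-* (B K) z))

bin-pos : ∀ {l} → true ∈ l → 1 ≤ bin l
bin-pos {true ∷ l}  (here refl) = s≤s z≤n
bin-pos {true ∷ l}  (there _)   = s≤s z≤n
bin-pos {false ∷ l} (there h)   = ℕP.≤-trans (bin-pos h) (ℕP.m≤m+n (bin l) _)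

a-pos : ∀ {v} → InR v → ∀ k → 1 ≤ a v (suc k)
a-pos hv k = bin-pos (hv k)

q-pos : ∀ {v} → InR v → ∀ k → 1 ≤ q v k
q-pos hv zero          = s≤s z≤n
q-pos hv (suc zero)    = subst (1 ≤_) (sym (ℕP.+-identityʳ _)) (subst (1 ≤_) (sym (ℕP.*-identityʳ _)) (a-pos hv 0))
q-pos hv (suc (suc k)) = ℕP.≤-trans (q-pos hv k) (ℕP.m≤n+m _ _)

a≢0 : ∀ {v} → InR v → ∀ k → a v (suc k) ≢ 0
a≢0 hv k a≡0 = ℕP.<-irrefl (sym a≡0) (a-pos hv k)

ℕ→ℚ*-≤ : ∀ z w x d → + z ℤ.* + x ℤ.≤ + w ℤ.* + suc d →
          ℕ→ℚ z Q.* mkℚᵘ (+ x) d Q.≤ ℕ→ℚ w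
ℕ→ℚ*-≤ z w x d =
  *≤* ∘ subst₂ ℤ._≤_ (sym (ℤP.*-identityʳ _)) (cong (λ k → + w ℤ.* + k) (sym (ℕP.*-identityˡ (suc d))))

-- q_n · Oapprox ht n is the sum below (digitSum-cross).
numerator≤0⇒Ononpos : ∀ {v t} → InR v → (ht : AFin v t) →
  (∀ n → AFin.supp ht ≤ n → sumFrom (AlternatingSum.term v (suc n) (digit t)) 1 (AFin.supp ht) ℤ.≤ + 0) →
  Ononpos ht
numerator≤0⇒Ononpos {v} {t} hv ht numerator≤0 m = K , λ n K≤n → QP.≤-trans (O≤0 n K≤n) (*≤* (+≤+ z≤n))
  where
  K : ℕ
  K = AFin.supp ht
  O≤0 : ∀ n → K ≤ n → Oapprox ht n Q.≤ 0ℚᵘ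
  O≤0 n K≤n = QP.≤-respˡ-≃ (QP.≃-sym (sumℚ-affine (λ k → digit t (suc k)) (q v) (p v) (conv v n) K))
                (QP.p≤q⇒p-q≤0 (ℕ→ℚ*-≤ ZQ ZP (p v n) (pred (q v n)) cross-multiplied))
    where
    open AlternatingSum v (suc n) (digit t)
    ZQ ZP : ℕ
    ZQ = sumℕ K (λ k → digit t (suc k) ℕ.* q v k)
    ZP = sumℕ K (λ k → digit t (suc k) ℕ.* p v k)
    cross-multiplied : + ZQ ℤ.* + p v n ℤ.≤ + ZP ℤ.* + suc (pred (q v n))
    cross-multiplied = subst (λ k → + ZQ ℤ.* + p v n ℤ.≤ + ZP ℤ.* + k)
                             (sym (ℕP.suc-pred (q v n) {{ℕ.>-nonZero (q-pos hv n)}}))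
      (ℤP.i-j≤0⇒i≤j (subst (ℤ._≤ + 0) (sym (digitSum-cross K)) (numerator≤0 n K≤n)))

zeroDigits⇒Ononpos : ∀ {v t} → InR v → (ht : AFin v t) → (∀ i → digit t i ≡ 0) → Ononpos ht
zeroDigits⇒Ononpos {v} {t} hv ht zeros = numerator≤0⇒Ononpos hv ht λ n _ →
  ℤP.≤-reflexive (sumFrom-zero (λ j → cong (λ k → + k ℤ.* CrossDeterminant.cross v j (suc n)) (zeros j))
                               1 (AFin.supp ht))

LeadsEven : (ℕ → ℕ) → Set
LeadsEven d = ∃[ j ] even j ≡ true × 1 ≤ d j × (∀ i → i < j → d i ≡ 0)

LeadsEven-cong : ∀ {d e} → (∀ k → d k ≡ e k) → LeadsEven d → LeadsEven e
LeadsEven-cong d≡e (j , ev , lead , below) =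
  j , ev , subst (1 ≤_) (d≡e j) lead , λ i i<j → trans (sym (d≡e i)) (below i i<j)

LeadsEven⇒Ononpos : ∀ {v t} → InR v → (ht : AFin v t) → LeadsEven (digit t) → Ononpos ht
LeadsEven⇒Ononpos {v} {t} hv ht (suc j , ev , lead , below) = numerator≤0⇒Ononpos hv ht λ n K≤n →
  lead-nonpos v (suc n) (digit t) (AFin.bounded ht) (AFin.supp ht) 1 ev lead below
              (s≤s z≤n) (s≤s j<K) (s≤s (ℕP.m≤n⇒m≤1+n K≤n))
  where
  open AlternatingSum using (lead-nonpos)
  j<K : j < AFin.supp ht
  j<K = ℕP.≰⇒> λ K≤j → ℕP.<-irrefl (sym (AFin.suppZero ht j K≤j)) lead

linearRecurrence-≤ : ∀ (c L R : ℕ → ℕ) →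
  (∀ n → L (suc (suc n)) ≡ c (suc n) ℕ.* L (suc n) ℕ.+ L n) →
  (∀ n → R (suc (suc n)) ≡ c (suc n) ℕ.* R (suc n) ℕ.+ R n) →
  ∀ n₀ → L n₀ ≤ R n₀ → L (suc n₀) ≤ R (suc n₀) → ∀ n → n₀ ≤ n → L n ≤ R n
linearRecurrence-≤ c L R L-rec R-rec n₀ h₀ h₁ n n₀≤n =
  subst (λ k → L k ≤ R k) (ℕP.m+[n∸m]≡n n₀≤n) (proj₁ (from (n ℕ.∸ n₀)))
  where
  from : ∀ d → L (n₀ ℕ.+ d) ≤ R (n₀ ℕ.+ d) × L (suc (n₀ ℕ.+ d)) ≤ R (suc (n₀ ℕ.+ d))
  from zero rewrite ℕP.+-identityʳ n₀ = h₀ , h₁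
  from (suc d) rewrite ℕP.+-suc n₀ d =
    let (i₀ , i₁) = from d in
    i₁ , subst₂ _≤_ (sym (L-rec _)) (sym (R-rec _))
                    (ℕP.+-mono-≤ (ℕP.*-monoʳ-≤ (c (suc (n₀ ℕ.+ d))) i₁) i₀)

ℕ→ℚ*-+eps-≤1 : ∀ z x d m → z ℕ.* x ℕ.* suc m ℕ.+ suc d ≤ suc d ℕ.* suc m →
               ℕ→ℚ z Q.* mkℚᵘ (+ x) d Q.+ eps m Q.≤ 1ℚᵘ
ℕ→ℚ*-+eps-≤1 z x d m h = *≤* (subst₂ ℤ._≤_ (sym lhs) (sym rhs) (+≤+ h))
  where
  open ≡-Reasoning
  lhs : ((+ z ℤ.* + x) ℤ.* + suc m ℤ.+ + 1 ℤ.* + (1 ℕ.* suc d)) ℤ.* + 1 ≡ + (z ℕ.* x ℕ.* suc m ℕ.+ suc d)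
  lhs = begin
    ((+ z ℤ.* + x) ℤ.* + suc m ℤ.+ + 1 ℤ.* + (1 ℕ.* suc d)) ℤ.* + 1
      ≡⟨ ℤP.*-identityʳ _ ⟩
    (+ z ℤ.* + x) ℤ.* + suc m ℤ.+ + 1 ℤ.* + (1 ℕ.* suc d)
      ≡⟨ cong₂ ℤ._+_ (trans (ℤP.pos-* (z ℕ.* x) (suc m)) (cong (ℤ._* + suc m) (ℤP.pos-* z x)))
                     (sym (trans (ℤP.*-identityˡ _) (cong +_ (ℕP.*-identityˡ (suc d))))) ⟨
    + (z ℕ.* x ℕ.* suc m) ℤ.+ + suc d
      ≡⟨ ℤP.pos-+ (z ℕ.* x ℕ.* suc m) (suc d) ⟨
    + (z ℕ.* x ℕ.* suc m ℕ.+ suc d) ∎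
  rhs : + 1 ℤ.* + ((1 ℕ.* suc d) ℕ.* suc m) ≡ + (suc d ℕ.* suc m)
  rhs = trans (ℤP.*-identityˡ _) (cong (λ k → + (k ℕ.* suc m)) (ℕP.*-identityˡ (suc d)))

-- The margin is 1/c with c = a₁a₂ + a₁ + 1: the inequality a₁ p_n c + q_n ≤ c q_n holds for
-- n = 2, 3 and both sides follow the recurrence of the convergents.
z≤a₁⇒zα<1 : ∀ {v} → InR v → ∀ z → z ≤ a v 1 → LimLt (λ n → ℕ→ℚ z Q.* conv v n) 1ℚᵘ
z≤a₁⇒zα<1 {v} hv z z≤a₁ = m , 2 , λ n 2≤n →
  ℕ→ℚ*-+eps-≤1 z (p v n) (pred (q v n)) m
    (subst (λ k → z ℕ.* p v n ℕ.* c ℕ.+ k ≤ k ℕ.* c) (q≡suc {n}) (bound n 2≤n))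
  where
  open ℕSolver.+-*-Solver
  x y m c : ℕ
  x = a v 1
  y = a v 2
  m = x ℕ.* y ℕ.+ x
  c = suc m
  q≡suc : ∀ {n} → q v n ≡ suc (pred (q v n))
  q≡suc {n} = sym (ℕP.suc-pred (q v n) {{ℕ.>-nonZero (q-pos hv n)}})
  L R : ℕ → ℕ
  L N = Qˢ v N ℕ.+ c ℕ.* x ℕ.* Pˢ v N
  R N = c ℕ.* Qˢ v N
  L-rec : ∀ N → L (suc (suc N)) ≡ a v (suc N) ℕ.* L (suc N) ℕ.+ L N
  L-rec N = solve 7 (λ e q₁ q₀ p₁ p₀ c x → (e :* q₁ :+ q₀) :+ c :* x :* (e :* p₁ :+ p₀) :=
                                           e :* (q₁ :+ c :* x :* p₁) :+ (q₀ :+ c :* x :* p₀))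
    refl (a v (suc N)) (Qˢ v (suc N)) (Qˢ v N) (Pˢ v (suc N)) (Pˢ v N) c x
  R-rec : ∀ N → R (suc (suc N)) ≡ a v (suc N) ℕ.* R (suc N) ℕ.+ R N
  R-rec N = solve 4 (λ e q₁ q₀ c → c :* (e :* q₁ :+ q₀) := e :* (c :* q₁) :+ c :* q₀)
    refl (a v (suc N)) (Qˢ v (suc N)) (Qˢ v N) c
  L≤R-3 : L 3 ≤ R 3
  L≤R-3 = subst (L 3 ≤_) (sym R₃≡L₃+x) (ℕP.m≤m+n (L 3) x)
    where
    R₃≡L₃+x : R 3 ≡ L 3 ℕ.+ x
    R₃≡L₃+x = solve 2 (λ x y →
      let c = con 1 :+ (x :* y :+ x)
          q₃ = y :* (x :* con 1 :+ con 0) :+ con 1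
          p₃ = y :* (x :* con 0 :+ con 1) :+ con 0
      in c :* q₃ := (q₃ :+ c :* x :* p₃) :+ x) refl x y
  L≤R-4 : L 4 ≤ R 4
  L≤R-4 = ℕP.+-cancelʳ-≤ x (L 4) (R 4) (begin
    L 4 ℕ.+ x             ≤⟨ ℕP.+-monoʳ-≤ (L 4) (ℕP.m≤m*n x (a v 3) {{ℕ.>-nonZero (a-pos hv 2)}}) ⟩
    L 4 ℕ.+ x ℕ.* a v 3   ≡⟨ R₄+x≡L₄+x*a₃ ⟨
    R 4 ℕ.+ x             ∎)
    where
    open ℕP.≤-Reasoning
    R₄+x≡L₄+x*a₃ : R 4 ℕ.+ x ≡ L 4 ℕ.+ x ℕ.* a v 3
    R₄+x≡L₄+x*a₃ = solve 3 (λ x y w →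
      let c = con 1 :+ (x :* y :+ x)
          q₂ = x :* con 1 :+ con 0
          p₂ = x :* con 0 :+ con 1
          q₄ = w :* (y :* q₂ :+ con 1) :+ q₂
          p₄ = w :* (y :* p₂ :+ con 0) :+ p₂
      in c :* q₄ :+ x := (q₄ :+ c :* x :* p₄) :+ x :* w) refl x y (a v 3)
  bound : ∀ n → 2 ≤ n → z ℕ.* p v n ℕ.* c ℕ.+ q v n ≤ q v n ℕ.* c
  bound n 2≤n = begin
    z ℕ.* p v n ℕ.* c ℕ.+ q v n
      ≤⟨ ℕP.+-monoˡ-≤ (q v n) (ℕP.*-monoˡ-≤ c (ℕP.*-monoˡ-≤ (p v n) z≤a₁)) ⟩
    x ℕ.* p v n ℕ.* c ℕ.+ q v n
      ≡⟨ solve 4 (λ x p c q → x :* p :* c :+ q := q :+ c :* x :* p) refl x (p v n) c (q v n) ⟩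
    L (suc n)                   ≤⟨ linearRecurrence-≤ (a v) L R L-rec R-rec 3 L≤R-3 L≤R-4 (suc n) (s≤s 2≤n) ⟩
    R (suc n)                   ≡⟨ ℕP.*-comm c (q v n) ⟩
    q v n ℕ.* c                 ∎
    where open ℕP.≤-Reasoning

-- Words with prescribed Ostrowski digits

half : ℕ → ℕ
half zero          = zero
half (suc zero)    = zero
half (suc (suc n)) = suc (half n)

odd? : ℕ → Bool
odd? zero          = false
odd? (suc zero)    = true
odd? (suc (suc n)) = odd? n

bit+2* : Bool → ℕ → ℕ
bit+2* false k = 2 ℕ.* k
bit+2* true  k = suc (2 ℕ.* k)

bin-∷ : ∀ b l → bin (b ∷ l) ≡ bit+2* b (bin l)
bin-∷ false l = refl
bin-∷ true  l = refl

bit+2*-half : ∀ x → bit+2* (odd? x) (half x) ≡ x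
bit+2*-half zero          = refl
bit+2*-half (suc zero)    = refl
bit+2*-half (suc (suc x)) = trans (shift (odd? x) (half x)) (cong (λ k → suc (suc k)) (bit+2*-half x))
  where
  shift : ∀ b h → bit+2* b (suc h) ≡ suc (suc (bit+2* b h))
  shift false h = ℕP.*-suc 2 h
  shift true  h = cong suc (ℕP.*-suc 2 h)

half-≤ : ∀ x k → x ≤ suc (2 ℕ.* k) → half x ≤ k
half-≤ zero          k       _       = z≤n
half-≤ (suc zero)    k       _       = z≤n
half-≤ (suc (suc x)) zero    (s≤s ())
half-≤ (suc (suc x)) (suc k) (s≤s h) = s≤s (half-≤ x k (ℕP.≤-pred (subst (suc x ≤_) (ℕP.*-suc 2 k) h)))

toBits : List Bool → ℕ → List Bool
toBits []      x = []
toBits (_ ∷ l) x = odd? x ∷ toBits l (half x)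

length-toBits : ∀ l x → length (toBits l x) ≡ length l
length-toBits []      x = refl
length-toBits (_ ∷ l) x = cong suc (length-toBits l (half x))

bin-toBits : ∀ l x → x ≤ bin l → bin (toBits l x) ≡ x
bin-toBits []      zero    _   = refl
bin-toBits []      (suc x) ()
bin-toBits (b ∷ l) x       x≤l = begin
  bin (toBits (b ∷ l) x)                   ≡⟨ bin-∷ (odd? x) (toBits l (half x)) ⟩
  bit+2* (odd? x) (bin (toBits l (half x)))
    ≡⟨ cong (bit+2* (odd? x)) (bin-toBits l (half x) (half-≤ x (bin l) x≤2l+1)) ⟩
  bit+2* (odd? x) (half x)                 ≡⟨ bit+2*-half x ⟩
  x                                        ∎
  where
  open ≡-Reasoning
  x≤2l+1 : x ≤ suc (2 ℕ.* bin l)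
  x≤2l+1 = ℕP.≤-trans x≤l (subst (_≤ suc (2 ℕ.* bin l)) (sym (bin-∷ b l)) (bit≤ b))
    where
    bit≤ : ∀ b → bit+2* b (bin l) ≤ suc (2 ℕ.* bin l)
    bit≤ false = ℕP.n≤1+n _
    bit≤ true  = ℕP.≤-refl

sumℕ-cong : ∀ K {f g} → (∀ n → n < K → f n ≡ g n) → sumℕ K f ≡ sumℕ K g
sumℕ-cong zero    _   = refl
sumℕ-cong (suc K) f≡g =
  cong₂ ℕ._+_ (sumℕ-cong K (λ n n<K → f≡g n (ℕP.m<n⇒m<1+n n<K))) (f≡g K ℕP.≤-refl)

sumℕ-vanishing-tail : ∀ {K K'} f → K ≤ K' → (∀ n → K ≤ n → f n ≡ 0) → sumℕ K' f ≡ sumℕ K f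
sumℕ-vanishing-tail f K≤K' = go (ℕP.≤⇒≤′ K≤K')
  where
  go : ∀ {K K'} → K ≤′ K' → (∀ n → K ≤ n → f n ≡ 0) → sumℕ K' f ≡ sumℕ K f
  go ≤′-refl                _     = refl
  go (≤′-step {K'} K≤′K') zeros =
    trans (cong₂ ℕ._+_ (go K≤′K' zeros) (zeros K' (ℕP.≤′⇒≤ K≤′K'))) (ℕP.+-identityʳ _)

sumℕ-agree-beyond : ∀ {A K} f g → A ≤ K → (∀ n → A ≤ n → f n ≡ g n) →
                    sumℕ K f ℕ.+ sumℕ A g ≡ sumℕ K g ℕ.+ sumℕ A f
sumℕ-agree-beyond {A} f g A≤K f≡g = go (ℕP.≤⇒≤′ A≤K)
  where
  swap : ∀ x y z → x ℕ.+ y ℕ.+ z ≡ x ℕ.+ z ℕ.+ y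
  swap x y z = trans (ℕP.+-assoc x y z) (trans (cong (x ℕ.+_) (ℕP.+-comm y z)) (sym (ℕP.+-assoc x z y)))
  go : ∀ {K} → A ≤′ K → sumℕ K f ℕ.+ sumℕ A g ≡ sumℕ K g ℕ.+ sumℕ A f
  go ≤′-refl = ℕP.+-comm (sumℕ A f) (sumℕ A g)
  go (≤′-step {K} A≤′K) = begin
    sumℕ K f ℕ.+ f K ℕ.+ sumℕ A g   ≡⟨ swap (sumℕ K f) (f K) (sumℕ A g) ⟩
    sumℕ K f ℕ.+ sumℕ A g ℕ.+ f K   ≡⟨ cong₂ ℕ._+_ (go A≤′K) (f≡g K (ℕP.≤′⇒≤ A≤′K)) ⟩
    sumℕ K g ℕ.+ sumℕ A f ℕ.+ g K   ≡⟨ swap (sumℕ K g) (g K) (sumℕ A f) ⟨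
    sumℕ K g ℕ.+ g K ℕ.+ sumℕ A f   ∎
    where open ≡-Reasoning

sumℕ-only-first : ∀ K f → 0 < K → (∀ n → 0 < n → n < K → f n ≡ 0) → sumℕ K f ≡ f 0
sumℕ-only-first (suc zero)    f _ _     = refl
sumℕ-only-first (suc (suc K)) f _ zeros =
  trans (cong₂ ℕ._+_ (sumℕ-only-first (suc K) f (s≤s z≤n) (λ n 0<n n<K → zeros n 0<n (ℕP.m<n⇒m<1+n n<K)))
                     (zeros (suc K) (s≤s z≤n) ℕP.≤-refl))
        (ℕP.+-identityʳ (f 0))

digitSum : Word → (ℕ → ℕ) → ℕ → ℕ
digitSum v d K = sumℕ K (λ n → d (suc n) ℕ.* q v n)

record IsOstrowski (v : Word) (d : ℕ → ℕ) : Set where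
  field
    first<   : d 1 < a v 1
    bounded  : ∀ n → d (suc n) ≤ a v (suc n)
    maxRule  : ∀ n → d (suc (suc n)) ≡ a v (suc (suc n)) → d (suc n) ≡ 0
    supp     : ℕ
    suppZero : ∀ n → supp ≤ n → d (suc n) ≡ 0

wordOf : Word → (ℕ → ℕ) → Word
wordOf v d k = toBits (v k) (d (suc k))

module _ {v : Word} {d : ℕ → ℕ} (od : IsOstrowski v d) where

  open IsOstrowski od

  digit-wordOf : ∀ k → digit (wordOf v d) (suc k) ≡ d (suc k)
  digit-wordOf k = bin-toBits (v k) (d (suc k)) (bounded k)

  digits-wordOf : d 0 ≡ 0 → ∀ k → digit (wordOf v d) k ≡ d k
  digits-wordOf d₀≡0 zero    = sym d₀≡0
  digits-wordOf d₀≡0 (suc k) = digit-wordOf k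

  fromDigits : AFin v (wordOf v d)
  fromDigits = record
    { aligned  = λ k → length-toBits (v k) (d (suc k))
    ; first<   = subst (_< a v 1) (sym (digit-wordOf 0)) first<
    ; bounded  = λ n → subst (_≤ a v (suc n)) (sym (digit-wordOf n)) (bounded n)
    ; maxRule  = λ n eq → trans (digit-wordOf n) (maxRule n (trans (sym (digit-wordOf (suc n))) eq))
    ; supp     = supp
    ; suppZero = λ n le → trans (digit-wordOf n) (suppZero n le)
    }

  Z-fromDigits : Z fromDigits ≡ digitSum v d supp
  Z-fromDigits = sumℕ-cong supp (λ n _ → cong (ℕ._* q v n) (digit-wordOf n))

Z≡digitSum : ∀ {v t} (ht : AFin v t) K → AFin.supp ht ≤ K → Z ht ≡ digitSum v (digit t) K
Z≡digitSum {v} ht K supp≤K =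
  sym (sumℕ-vanishing-tail _ supp≤K (λ n supp≤n → cong (ℕ._* q v n) (AFin.suppZero ht n supp≤n)))

digitSum-stable : ∀ {v d} (od : IsOstrowski v d) K → IsOstrowski.supp od ≤ K →
                  digitSum v d K ≡ digitSum v d (IsOstrowski.supp od)
digitSum-stable {v} od K supp≤K =
  sumℕ-vanishing-tail _ supp≤K (λ n supp≤n → cong (ℕ._* q v n) (IsOstrowski.suppZero od n supp≤n))

module _ {v : Word} (hv : InR v) where

  private
    atOne : ℕ → ℕ → ℕ
    atOne z (suc zero) = z
    atOne z _          = 0

    atTwo : ℕ → ℕ
    atTwo (suc (suc zero)) = 1
    atTwo _                = 0

    atOne-Ostrowski : ∀ {z} → z < a v 1 → IsOstrowski v (atOne z)
    atOne-Ostrowski {z} z<a₁ = record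
      { first<   = z<a₁
      ; bounded  = λ { zero → ℕP.<⇒≤ z<a₁ ; (suc n) → z≤n }
      ; maxRule  = λ n a≡0 → ⊥-elim (a≢0 hv (suc n) (sym a≡0))
      ; supp     = 1
      ; suppZero = λ { (suc n) _ → refl }
      }

    atTwo-Ostrowski : IsOstrowski v atTwo
    atTwo-Ostrowski = record
      { first<   = a-pos hv 0
      ; bounded  = λ { zero → z≤n ; (suc zero) → a-pos hv 1 ; (suc (suc n)) → z≤n }
      ; maxRule  = λ { zero _ → refl ; (suc n) a≡0 → ⊥-elim (a≢0 hv (suc (suc n)) (sym a≡0)) }
      ; supp     = 2
      ; suppZero = λ { (suc (suc n)) _ → refl ; (suc zero) (s≤s ()) }
      }

  -- z = a₁ = q₁ is written with the digit of q₁, since b₁ < a₁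
  Z-onto-≤a₁ : ∀ z → z ≤ a v 1 → Σ Word λ s → Σ (AFin v s) λ hs → Z hs ≡ z
  Z-onto-≤a₁ z z≤a₁ with ℕP.m≤n⇒m<n∨m≡n z≤a₁
  ... | inj₁ z<a₁ = wordOf v (atOne z) , fromDigits od , trans (Z-fromDigits od) (ℕP.*-identityʳ z)
    where
    od : IsOstrowski v (atOne z)
    od = atOne-Ostrowski z<a₁
  ... | inj₂ refl = wordOf v atTwo , fromDigits atTwo-Ostrowski , trans (Z-fromDigits atTwo-Ostrowski)
    (solve 1 (λ x → con 0 :+ con 0 :* con 1 :+ con 1 :* (x :* con 1 :+ con 0) := x) refl (a v 1))
    where open ℕSolver.+-*-Solver

-- Splitting off Z_v(s)

leastNonzero : ∀ (f : ℕ → ℕ) K → (∀ i → K ≤ i → f i ≡ 0) →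
               (∀ i → f i ≡ 0) ⊎ ∃[ i ] 1 ≤ f i × (∀ i' → i' < i → f i' ≡ 0)
leastNonzero f zero    zeros = inj₁ (λ i → zeros i z≤n)
leastNonzero f (suc K) zeros with f 0 in f₀
... | suc _ = inj₂ (0 , subst (1 ≤_) (sym f₀) (s≤s z≤n) , λ _ ())
... | zero with leastNonzero (λ i → f (suc i)) K (λ i K≤i → zeros (suc i) (s≤s K≤i))
...   | inj₁ zeros' = inj₁ λ { zero → f₀ ; (suc i) → zeros' i }
...   | inj₂ (i , lead , below) = inj₂ (suc i , lead , λ { zero _ → f₀ ; (suc i') (s≤s i'<i) → below i' i'<i })

evenPart : Word → ℕ → ℕ
evenPart v m = if even m then a v m else 0

evenPart-≤ : ∀ v n → evenPart v n ≤ a v n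
evenPart-≤ v n with even n
... | true  = ℕP.≤-refl
... | false = z≤n

evenPart-maxRule : ∀ {v} → InR v → ∀ n → evenPart v (suc (suc n)) ≡ a v (suc (suc n)) → evenPart v (suc n) ≡ 0
evenPart-maxRule hv n eq with even n
... | true  = refl
... | false = ⊥-elim (a≢0 hv (suc n) (sym eq))

q-telescope : ∀ v M → even M ≡ true → 1 ℕ.+ digitSum v (evenPart v) M ≡ q v M
q-telescope v zero          _  = refl
q-telescope v (suc zero)    ()
q-telescope v (suc (suc M)) ev with even M in evM
q-telescope v (suc (suc M)) () | false
q-telescope v (suc (suc M)) _  | true = begin
  1 ℕ.+ (S ℕ.+ 0 ℕ.+ a v (suc (suc M)) ℕ.* q v (suc M))
    ≡⟨ solve 2 (λ s x → con 1 :+ (s :+ con 0 :+ x) := x :+ (con 1 :+ s))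
             refl S (a v (suc (suc M)) ℕ.* q v (suc M)) ⟩
  a v (suc (suc M)) ℕ.* q v (suc M) ℕ.+ (1 ℕ.+ S)
    ≡⟨ cong (a v (suc (suc M)) ℕ.* q v (suc M) ℕ.+_) (q-telescope v M evM) ⟩
  a v (suc (suc M)) ℕ.* q v (suc M) ℕ.+ q v M ∎
  where
  open ≡-Reasoning
  open ℕSolver.+-*-Solver
  S : ℕ
  S = digitSum v (evenPart v) M

Z-fromDigits-agree : ∀ {v t d} (ht : AFin v t) (od : IsOstrowski v d) A →
  (∀ n → A ≤ n → digit t (suc n) ≡ d (suc n)) →
  Z ht ℕ.+ digitSum v d A ≡ Z (fromDigits od) ℕ.+ digitSum v (digit t) A
Z-fromDigits-agree {v} {t} {d} ht od A agree = begin
  Z ht ℕ.+ digitSum v d A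
    ≡⟨ cong (ℕ._+ digitSum v d A) (Z≡digitSum ht K (ℕP.≤-trans (ℕP.m≤m+n _ _) (ℕP.m≤n+m _ A))) ⟩
  digitSum v (digit t) K ℕ.+ digitSum v d A
    ≡⟨ sumℕ-agree-beyond _ _ (ℕP.m≤m+n A _) (λ n A≤n → cong (ℕ._* q v n) (agree n A≤n)) ⟩
  digitSum v d K ℕ.+ digitSum v (digit t) A
    ≡⟨ cong (ℕ._+ digitSum v (digit t) A) (digitSum-stable od K (ℕP.≤-trans (ℕP.m≤n+m _ _) (ℕP.m≤n+m _ A))) ⟩
  digitSum v d (IsOstrowski.supp od) ℕ.+ digitSum v (digit t) A
    ≡⟨ cong (ℕ._+ digitSum v (digit t) A) (Z-fromDigits od) ⟨
  Z (fromDigits od) ℕ.+ digitSum v (digit t) A ∎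
  where
  open ≡-Reasoning
  K : ℕ
  K = A ℕ.+ (AFin.supp ht ℕ.+ IsOstrowski.supp od)

cancel-heads : ∀ {x y h h' c} → x ℕ.+ h' ≡ y ℕ.+ h → h ≡ h' ℕ.+ c → x ≡ y ℕ.+ c
cancel-heads {x} {y} {h} {h'} {c} eq refl = ℕP.+-cancelʳ-≡ h' x (y ℕ.+ c)
  (trans eq (trans (cong (y ℕ.+_) (ℕP.+-comm h' c)) (sym (ℕP.+-assoc y c h'))))

dropFirst : (ℕ → ℕ) → ℕ → ℕ
dropFirst b (suc zero) = 0
dropFirst b m          = b m

Decomposition : ∀ {v t} → AFin v t → Set
Decomposition {v} ht =
  ∃[ c ] c ≤ a v 1 × Σ Word λ t' → Σ (AFin v t') λ ht' → Ononpos ht' × Z ht ≡ Z ht' ℕ.+ c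

module _ {v t : Word} (hv : InR v) (ht : AFin v t) where

  private
    b : ℕ → ℕ
    b = digit t
    K : ℕ
    K = AFin.supp ht

  dropFirst-Ostrowski : IsOstrowski v (dropFirst b)
  dropFirst-Ostrowski = record
    { first<   = a-pos hv 0
    ; bounded  = λ { zero → z≤n ; (suc n) → AFin.bounded ht (suc n) }
    ; maxRule  = λ { zero _ → refl ; (suc n) → AFin.maxRule ht (suc n) }
    ; supp     = K
    ; suppZero = λ { zero _ → refl ; (suc n) → AFin.suppZero ht (suc n) }
    }

  decompose-dropFirst : (∀ i → dropFirst b i ≡ 0) ⊎ LeadsEven (dropFirst b) → Decomposition ht
  decompose-dropFirst zeros-or-lead =
    b 1 , ℕP.<⇒≤ (AFin.first< ht) , wordOf v (dropFirst b) , fromDigits od , O≤0 zeros-or-lead ,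
    cancel-heads (Z-fromDigits-agree ht od 1 λ { (suc n) _ → refl }) (ℕP.*-identityʳ (b 1))
    where
    od : IsOstrowski v (dropFirst b)
    od = dropFirst-Ostrowski
    O≤0 : (∀ i → dropFirst b i ≡ 0) ⊎ LeadsEven (dropFirst b) → Ononpos (fromDigits od)
    O≤0 (inj₁ zeros) =
      zeroDigits⇒Ononpos hv (fromDigits od) (λ k → trans (digits-wordOf od refl k) (zeros k))
    O≤0 (inj₂ even-lead) =
      LeadsEven⇒Ononpos hv (fromDigits od) (LeadsEven-cong (λ k → sym (digits-wordOf od refl k)) even-lead)

  module Borrow (m : ℕ) (2≤m : 2 ≤ m) (even-m : even m ≡ true) (lead : 1 ≤ b (suc m))
                (gap : ∀ n → 0 < n → n < m → b (suc n) ≡ 0) where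

    borrow : ℕ → ℕ
    borrow n with ℕP.<-cmp n (suc m)
    ... | tri< _ _ _ = evenPart v n
    ... | tri≈ _ _ _ = pred (b (suc m))
    ... | tri> _ _ _ = b n

    borrow-< : ∀ {n} → n < suc m → borrow n ≡ evenPart v n
    borrow-< {n} n<j with ℕP.<-cmp n (suc m)
    ... | tri< _ _ _   = refl
    ... | tri≈ _ n≡j _ = ⊥-elim (ℕP.<-irrefl n≡j n<j)
    ... | tri> _ _ j<n = ⊥-elim (ℕP.<-asym n<j j<n)

    borrow-≡ : borrow (suc m) ≡ pred (b (suc m))
    borrow-≡ with ℕP.<-cmp (suc m) (suc m)
    ... | tri< j<j _ _ = ⊥-elim (ℕP.<-irrefl refl j<j)
    ... | tri≈ _ _ _   = refl
    ... | tri> _ _ j<j = ⊥-elim (ℕP.<-irrefl refl j<j)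

    borrow-> : ∀ {n} → suc m < n → borrow n ≡ b n
    borrow-> {n} j<n with ℕP.<-cmp n (suc m)
    ... | tri< n<j _ _ = ⊥-elim (ℕP.<-asym n<j j<n)
    ... | tri≈ _ n≡j _ = ⊥-elim (ℕP.<-irrefl (sym n≡j) j<n)
    ... | tri> _ _ _   = refl

    private
      m<K : m < K
      m<K = ℕP.≰⇒> λ K≤m → ℕP.<-irrefl (sym (AFin.suppZero ht m K≤m)) lead

      pred<a : pred (b (suc m)) < a v (suc m)
      pred<a = ℕP.≤-trans (ℕP.≤-reflexive (ℕP.suc-pred (b (suc m)) {{ℕ.>-nonZero lead}})) (AFin.bounded ht m)

      borrow-maxRule : ∀ n → borrow (suc (suc n)) ≡ a v (suc (suc n)) → borrow (suc n) ≡ 0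
      borrow-maxRule n eq with ℕP.<-cmp (suc n) m
      ... | tri< n+1<m _ _ = trans (borrow-< (ℕP.<-trans (ℕP.n<1+n (suc n)) (s≤s n+1<m)))
                                   (evenPart-maxRule hv n (trans (sym (borrow-< (s≤s n+1<m))) eq))
      ... | tri≈ _ refl _  = ⊥-elim (ℕP.<-irrefl (trans (sym borrow-≡) eq) pred<a)
      ... | tri> _ _ m<n+1 with ℕP.m≤n⇒m<n∨m≡n m<n+1 | AFin.maxRule ht n (trans (sym (borrow-> (s≤s m<n+1))) eq)
      ...   | inj₁ j<n+1 | bₙ₊₁≡0 = trans (borrow-> j<n+1) bₙ₊₁≡0
      ...   | inj₂ refl  | bⱼ≡0   = ⊥-elim (ℕP.<-irrefl (sym bⱼ≡0) lead)

    borrow-Ostrowski : IsOstrowski v borrow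
    borrow-Ostrowski = record
      { first<   = subst (_< a v 1) (sym (borrow-< (s≤s (ℕP.≤-trans (s≤s z≤n) 2≤m)))) (a-pos hv 0)
      ; bounded  = bounded
      ; maxRule  = borrow-maxRule
      ; supp     = K
      ; suppZero = λ n K≤n → trans (borrow-> (s≤s (ℕP.<-≤-trans m<K K≤n))) (AFin.suppZero ht n K≤n)
      }
      where
      bounded : ∀ n → borrow (suc n) ≤ a v (suc n)
      bounded n with ℕP.<-cmp n m
      ... | tri< n<m _ _  = subst (_≤ a v (suc n)) (sym (borrow-< (s≤s n<m))) (evenPart-≤ v (suc n))
      ... | tri≈ _ refl _ = subst (_≤ a v (suc m)) (sym borrow-≡) (ℕP.<⇒≤ pred<a)
      ... | tri> _ _ m<n  = subst (_≤ a v (suc n)) (sym (borrow-> (s≤s m<n))) (AFin.bounded ht n)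

    private
      od : IsOstrowski v borrow
      od = borrow-Ostrowski

      heads : digitSum v b (suc m) ≡ digitSum v borrow (suc m) ℕ.+ (b 1 ℕ.+ 1)
      heads = begin
        digitSum v b m ℕ.+ b (suc m) ℕ.* q v m  ≡⟨ cong₂ (λ h x → h ℕ.+ x ℕ.* q v m) low-digits bⱼ≡1+B ⟩
        b 1 ℕ.* 1 ℕ.+ suc B ℕ.* q v m           ≡⟨ cong (λ y → b 1 ℕ.* 1 ℕ.+ suc B ℕ.* y) 1+X≡q ⟨
        b 1 ℕ.* 1 ℕ.+ suc B ℕ.* (1 ℕ.+ X)
          ≡⟨ solve 3 (λ b₁ B X → b₁ :* con 1 :+ (con 1 :+ B) :* (con 1 :+ X) :=
                                 X :+ B :* (con 1 :+ X) :+ (b₁ :+ con 1)) refl (b 1) B X ⟩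
        X ℕ.+ B ℕ.* (1 ℕ.+ X) ℕ.+ (b 1 ℕ.+ 1)   ≡⟨ cong (λ y → X ℕ.+ B ℕ.* y ℕ.+ (b 1 ℕ.+ 1)) 1+X≡q ⟩
        X ℕ.+ B ℕ.* q v m ℕ.+ (b 1 ℕ.+ 1)       ≡⟨ cong (λ y → X ℕ.+ y ℕ.* q v m ℕ.+ (b 1 ℕ.+ 1)) borrow-≡ ⟨
        X ℕ.+ borrow (suc m) ℕ.* q v m ℕ.+ (b 1 ℕ.+ 1) ∎
        where
        open ≡-Reasoning
        open ℕSolver.+-*-Solver
        B X : ℕ
        B = pred (b (suc m))
        X = digitSum v borrow m
        bⱼ≡1+B : b (suc m) ≡ suc B
        bⱼ≡1+B = sym (ℕP.suc-pred (b (suc m)) {{ℕ.>-nonZero lead}})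
        low-digits : digitSum v b m ≡ b 1 ℕ.* 1
        low-digits = sumℕ-only-first m _ (ℕP.<-trans (s≤s z≤n) 2≤m)
                                     (λ n 0<n n<m → cong (ℕ._* q v n) (gap n 0<n n<m))
        1+X≡q : 1 ℕ.+ X ≡ q v m
        1+X≡q = trans (cong suc (sumℕ-cong m (λ n n<m → cong (ℕ._* q v n) (borrow-< (s≤s n<m)))))
                      (q-telescope v m even-m)

      borrow-LeadsEven : LeadsEven borrow
      borrow-LeadsEven = 2 , refl , subst (1 ≤_) (sym (borrow-< (s≤s 2≤m))) (a-pos hv 1) ,
        λ { zero          _                 → borrow-< (s≤s z≤n)
          ; (suc zero)    _                 → borrow-< (s≤s (ℕP.<-trans (s≤s z≤n) 2≤m))
          ; (suc (suc _)) (s≤s (s≤s ())) }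

    decompose-borrow : Decomposition ht
    decompose-borrow =
      b 1 ℕ.+ 1 , subst (_≤ a v 1) (ℕP.+-comm 1 (b 1)) (AFin.first< ht) , wordOf v borrow , fromDigits od ,
      LeadsEven⇒Ononpos hv (fromDigits od)
        (LeadsEven-cong (λ k → sym (digits-wordOf od (borrow-< (s≤s z≤n)) k)) borrow-LeadsEven) ,
      cancel-heads {y = Z (fromDigits od)}
        (Z-fromDigits-agree ht od (suc m) (λ n m<n → sym (borrow-> (s≤s m<n)))) heads

  decompose : Decomposition ht
  decompose with leastNonzero (λ i → b (suc (suc i))) K
                              (λ i K≤i → AFin.suppZero ht (suc i) (ℕP.m≤n⇒m≤1+n K≤i))
  ... | inj₁ zeros = decompose-dropFirst (inj₁ λ { zero → refl ; (suc zero) → refl ; (suc (suc i)) → zeros i })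
  ... | inj₂ (i , lead , below) with even i in even-i
  ...   | true  = decompose-dropFirst (inj₂ (suc (suc i) , trans (even-+2 i) even-i , lead ,
                    λ { zero _ → refl ; (suc zero) _ → refl ; (suc (suc i')) (s≤s (s≤s i'<i)) → below i' i'<i }))
  ...   | false = Borrow.decompose-borrow (suc i) (s≤s (odd⇒1≤ i even-i)) (cong not even-i) lead
                    λ { (suc n) _ (s≤s n<i) → below n n<i }
    where
    odd⇒1≤ : ∀ i → even i ≡ false → 1 ≤ i
    odd⇒1≤ (suc i) _ = s≤s z≤n

lemma5p5 : (v : Word) → InR v → (t : Word) (ht : AFin v t) →
    Σ Word λ s → Σ (AFin v s) λ hs → Σ Word λ t' → Σ (AFin v t') λ ht' →
    InF hs × Ononpos ht' × Z ht ≡ Z ht' + Z hs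
lemma5p5 v hv t ht with decompose hv ht
... | c , c≤a₁ , t' , ht' , O≤0 , Z≡Z'+c with Z-onto-≤a₁ hv c c≤a₁
...   | s , hs , Zs≡c =
  s , hs , t' , ht' , z≤a₁⇒zα<1 hv (Z hs) (subst (_≤ a v 1) (sym Zs≡c) c≤a₁) , O≤0 ,
  trans Z≡Z'+c (cong (λ z → Z ht' + z) (sym Zs≡c))
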